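{- Let $p>q\geq1$ be integers with $p>3$, and let $u_\beta$ be the unique fixed point of the morphism $\varphi(0)=0^p1$, $\varphi(1)=0^q1$ on $\{0,1\}^*$. Let $T(x)=0^q1\varphi(x)0^q$ for $x\in\{0,1\}^*$. Let $w$ be a factor of $u_\beta$ containing at least two letters $1$, let $w'$ be a proper prefix of $w$, and put $v=w^kw'$ for some integer $k\geq p$. Suppose there exist $a,b\in\{0,1\}$ such that $avb\in\mathcal L(u_\beta)$, $w'b$ is not a prefix of $w$, and $a$ is not a suffix of $w$. Then there exist a unique word $\tilde w$ with $|\tilde w|\geq2$ and a proper prefix $\tilde w'$ of $\tilde w$ such that $$w=0^q1\,\varphi(\tilde w)\,(0^q1)^{ -1}\quad\text{and}\quad v=T(\tilde v)\ \text{ where }\ \tilde v=\tilde w^k\tilde w';$$ moreover $a\tilde v b\in\mathcal L(u_\beta)$, $\tilde w'b$ is not a prefix of $\tilde w$, and $a$ is not a suffix of $\tilde w$.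
   Context: $\mathcal L(u_\beta)$ is the set of finite factors of $u_\beta$. For words $y,z$ with $y=y'z$, the notation $yz^{ -1}$ denotes $y'$ (erase the suffix $z$). $w^k$ denotes concatenation of $k$ copies of $w$. -}

module Defs where

open import Data.Nat using (ℕ; zero; suc)
open import Data.List using (List; []; _∷_; _++_; replicate; concatMap)
open import Data.Product using (Σ; ∃; _×_; _,_)
open import Relation.Binary.PropositionalEquality using (_≡_; _≢_)

data Letter : Set where
  𝟎 𝟏 : Letter

Word : Set
Word = List Letter

_^ʷ_ : Word → ℕ → Word
w ^ʷ zero  = []
w ^ʷ suc k = w ++ (w ^ʷ k)

count𝟏 : Word → ℕ
count𝟏 []       = zero
count𝟏 (𝟎 ∷ w) = count𝟏 w
count𝟏 (𝟏 ∷ w) = suc (count𝟏 w)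

φₗ : ℕ → ℕ → Letter → Word
φₗ p q 𝟎 = replicate p 𝟎 ++ (𝟏 ∷ [])
φₗ p q 𝟏 = replicate q 𝟎 ++ (𝟏 ∷ [])

φ : ℕ → ℕ → Word → Word
φ p q = concatMap (φₗ p q)

φ^ : ℕ → ℕ → ℕ → Word → Word
φ^ p q zero    w = w
φ^ p q (suc n) w = φ p q (φ^ p q n w)

T : ℕ → ℕ → Word → Word
T p q x = replicate q 𝟎 ++ (𝟏 ∷ []) ++ φ p q x ++ replicate q 𝟎

IsPrefix : Word → Word → Set
IsPrefix u w = ∃ λ s → w ≡ u ++ s

IsProperPrefix : Word → Word → Set
IsProperPrefix u w = ∃ λ s → (s ≢ []) × (w ≡ u ++ s)

IsSuffix : Word → Word → Set
IsSuffix u w = ∃ λ s → w ≡ s ++ u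

-- Since φ(0) begins with 0, each φ^n(0) is a prefix of u_β and these prefixes
-- exhaust u_β, so a finite word is a factor of u_β iff it is a factor of some φ^n(0).
InL : ℕ → ℕ → Word → Set
InL p q w = Σ ℕ λ n → Σ Word λ x → Σ Word λ y → φ^ p q n (𝟎 ∷ []) ≡ x ++ w ++ y

{-# OPTIONS --safe #-}
-- In u_β the zero run between two consecutive 1s has length p or q, 0^(p+1) and 11 are not
-- factors, and 1 0^r is right special only for r = q.  Reading the gaps in a w and w w shows that
-- w = 0^q 1 (mid) 1 0^m with m = 0 when a = 0 and m = p − q when a = 1; since 1 mid 1 is a factor,
-- mid 1 = φ(y), and w 0^q 1 = 0^q 1 φ(w̃) for w̃ = y 1 resp. y 0.  Because w′b is not a prefix of w,
-- the letter c after w′ in w differs from b.  If w′ contains a 1, the run 1 0^r ending w′ is then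
-- right special, r = q, w′ = 0^q 1 φ(w̃′) 0^q and v = T(w̃^k w̃′).  If w′ = 0^i, then v b either
-- ends with a forbidden gap or desubstitutes to 0 (y1)^(k−1) y 0 or 1 (y0)^(k−1) y 1, which the
-- gap lengths rule out once k ≥ p ≥ 4.  Uniqueness is injectivity of φ, and a ṽ b ∈ L(u_β)
-- because a T(ṽ) b can only occur in u_β as the image of a ṽ b.
module Submission where

open import Defs
open import Data.Nat using (ℕ; zero; suc; _+_; _*_; _≤_; _<_; z≤n; s≤s)
open import Data.Nat.Properties
open import Data.List using (List; []; _∷_; _++_; [_]; replicate; length; concat; map)
open import Data.List.Properties
  using ( ++-assoc; ++-identityʳ; ++-cancelˡ; ++-cancelʳ; ∷-injective; ∷-injectiveʳ; ∷-injectiveˡ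
        ; ∷ʳ-injective; ∷ʳ-injectiveˡ; map-++; concat-++; length-++; ++-monoid)
open import Data.Product using (Σ; Σ-syntax; _×_; _,_; proj₁; proj₂; map₂)
open import Data.Sum using (_⊎_; inj₁; inj₂)
open import Data.Empty using (⊥-elim)
open import Relation.Nullary using (¬_)
open import Relation.Binary.PropositionalEquality hiding ([_])
open import Algebra.Solver.Monoid (++-monoid Letter) using (solve; _⊜_; _⊕_)

infix 25 𝟎^_

𝟎^_ : ℕ → Word
𝟎^ n = replicate n 𝟎

[]≢++∷ : ∀ {A : Set} (U : List A) {x : A} {V : List A} → [] ≢ U ++ x ∷ V
[]≢++∷ [] ()
[]≢++∷ (u ∷ U) ()

𝟎^-+ : ∀ m n → 𝟎^ m ++ 𝟎^ n ≡ 𝟎^ (m + n)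
𝟎^-+ zero n = refl
𝟎^-+ (suc m) n = cong (𝟎 ∷_) (𝟎^-+ m n)

𝟎^-∷ʳ : ∀ n → 𝟎^ n ++ [ 𝟎 ] ≡ 𝟎 ∷ 𝟎^ n
𝟎^-∷ʳ zero = refl
𝟎^-∷ʳ (suc n) = cong (𝟎 ∷_) (𝟎^-∷ʳ n)

𝟎^-^ʷ : ∀ k n → 𝟎^ n ^ʷ k ≡ 𝟎^ (k * n)
𝟎^-^ʷ zero n = refl
𝟎^-^ʷ (suc k) n = trans (cong (𝟎^ n ++_) (𝟎^-^ʷ k n)) (𝟎^-+ n (k * n))

^ʷ-sucʳ : ∀ (u : Word) n → u ^ʷ suc n ≡ u ^ʷ n ++ u
^ʷ-sucʳ u zero = ++-identityʳ u
^ʷ-sucʳ u (suc n) = trans (cong (u ++_) (^ʷ-sucʳ u n)) (sym (++-assoc u (u ^ʷ n) u))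

𝟎^𝟏-injective : ∀ m n {X Y} → 𝟎^ m ++ 𝟏 ∷ X ≡ 𝟎^ n ++ 𝟏 ∷ Y → m ≡ n × X ≡ Y
𝟎^𝟏-injective zero zero eq = refl , ∷-injectiveʳ eq
𝟎^𝟏-injective (suc m) (suc n) eq with 𝟎^𝟏-injective m n (∷-injectiveʳ eq)
... | refl , X≡Y = refl , X≡Y

𝟎^𝟏≢longer-𝟎^ : ∀ m n {X Y} → m < n → 𝟎^ m ++ 𝟏 ∷ X ≢ 𝟎^ n ++ Y
𝟎^𝟏≢longer-𝟎^ zero (suc n) _ ()
𝟎^𝟏≢longer-𝟎^ (suc m) (suc n) (s≤s m<n) eq = 𝟎^𝟏≢longer-𝟎^ m n m<n (∷-injectiveʳ eq)

count𝟏-𝟎^ : ∀ n → count𝟏 (𝟎^ n) ≡ 0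
count𝟏-𝟎^ zero = refl
count𝟏-𝟎^ (suc n) = count𝟏-𝟎^ n

count𝟏≡0⇒𝟎^ : ∀ w → count𝟏 w ≡ 0 → Σ[ t ∈ ℕ ] w ≡ 𝟎^ t
count𝟏≡0⇒𝟎^ [] _ = 0 , refl
count𝟏≡0⇒𝟎^ (𝟎 ∷ w) eq with count𝟏≡0⇒𝟎^ w eq
... | t , refl = suc t , refl

first𝟏 : ∀ w {n} → count𝟏 w ≡ suc n → Σ[ j ∈ ℕ ] Σ[ r ∈ Word ] w ≡ 𝟎^ j ++ 𝟏 ∷ r × count𝟏 r ≡ n
first𝟏 (𝟎 ∷ w) eq with first𝟏 w eq
... | j , r , refl , count-r = suc j , r , refl , count-r
first𝟏 (𝟏 ∷ w) eq = 0 , w , refl , suc-injective eq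

𝟎≢⇒≡𝟏 : ∀ {b} → 𝟎 ≢ b → b ≡ 𝟏
𝟎≢⇒≡𝟏 {𝟎} 𝟎≢𝟎 = ⊥-elim (𝟎≢𝟎 refl)
𝟎≢⇒≡𝟏 {𝟏} _ = refl

𝟏≢⇒≡𝟎 : ∀ {b} → 𝟏 ≢ b → b ≡ 𝟎
𝟏≢⇒≡𝟎 {𝟎} _ = refl
𝟏≢⇒≡𝟎 {𝟏} 𝟏≢𝟏 = ⊥-elim (𝟏≢𝟏 refl)

EmptyOrEnds𝟏 : Word → Set
EmptyOrEnds𝟏 X = X ≡ [] ⊎ Σ[ X′ ∈ Word ] X ≡ X′ ++ [ 𝟏 ]

𝟏∷-emptyOrEnds𝟏 : ∀ {X} → EmptyOrEnds𝟏 X → Σ[ P ∈ Word ] 𝟏 ∷ X ≡ P ++ [ 𝟏 ]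
𝟏∷-emptyOrEnds𝟏 (inj₁ refl) = [] , refl
𝟏∷-emptyOrEnds𝟏 (inj₂ (X′ , refl)) = 𝟏 ∷ X′ , refl

split-trailing-𝟎s : ∀ x → Σ[ X ∈ Word ] Σ[ r ∈ ℕ ] x ≡ X ++ 𝟎^ r × EmptyOrEnds𝟏 X
split-trailing-𝟎s [] = [] , 0 , refl , inj₁ refl
split-trailing-𝟎s (d ∷ x) with split-trailing-𝟎s x
... | _ , r , refl , inj₂ (X′ , refl) = d ∷ X′ ++ [ 𝟏 ] , r , refl , inj₂ (d ∷ X′ , refl)
split-trailing-𝟎s (𝟎 ∷ x) | _ , r , refl , inj₁ refl = [] , suc r , refl , inj₁ refl
split-trailing-𝟎s (𝟏 ∷ x) | _ , r , refl , inj₁ refl = [ 𝟏 ] , r , refl , inj₂ ([] , refl)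

last𝟏 : ∀ w {n} → count𝟏 w ≡ suc n → Σ[ P ∈ Word ] Σ[ r ∈ ℕ ] w ≡ P ++ 𝟏 ∷ 𝟎^ r
last𝟏 w eq with split-trailing-𝟎s w
... | _ , r , refl , inj₂ (P , refl) = P , r , ++-assoc P [ 𝟏 ] (𝟎^ r)
... | _ , r , refl , inj₁ refl with trans (sym (count𝟏-𝟎^ r)) eq
... | ()

split-𝟎^𝟏-++-at-𝟏 : ∀ n A {R X} → (𝟎^ n ++ [ 𝟏 ]) ++ X ≡ A ++ 𝟏 ∷ R →
  (A ≡ 𝟎^ n × R ≡ X) ⊎ (Σ[ A′ ∈ Word ] A ≡ (𝟎^ n ++ [ 𝟏 ]) ++ A′ × X ≡ A′ ++ 𝟏 ∷ R)
split-𝟎^𝟏-++-at-𝟏 zero [] eq = inj₁ (refl , sym (∷-injectiveʳ eq))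
split-𝟎^𝟏-++-at-𝟏 zero (_ ∷ A) eq with ∷-injective eq
... | refl , eq′ = inj₂ (A , refl , eq′)
split-𝟎^𝟏-++-at-𝟏 (suc n) (_ ∷ A) eq with ∷-injective eq
... | refl , eq′ with split-𝟎^𝟏-++-at-𝟏 n A eq′
... | inj₁ (refl , R≡X) = inj₁ (refl , R≡X)
... | inj₂ (A′ , refl , X≡) = inj₂ (A′ , refl , X≡)

split-𝟎^𝟏-++ : ∀ n x {Y G} → (𝟎^ n ++ [ 𝟏 ]) ++ Y ≡ x ++ G →
  (Σ[ x′ ∈ Word ] x ≡ (𝟎^ n ++ [ 𝟏 ]) ++ x′ × Y ≡ x′ ++ G) ⊎ (Σ[ j ∈ ℕ ] j ≤ n × G ≡ 𝟎^ j ++ 𝟏 ∷ Y)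
split-𝟎^𝟏-++ n [] {Y} eq = inj₂ (n , ≤-refl , trans (sym eq) (++-assoc (𝟎^ n) [ 𝟏 ] Y))
split-𝟎^𝟏-++ zero (_ ∷ x) eq with ∷-injective eq
... | refl , eq′ = inj₁ (x , refl , eq′)
split-𝟎^𝟏-++ (suc n) (_ ∷ x) eq with ∷-injective eq
... | refl , eq′ with split-𝟎^𝟏-++ n x eq′
... | inj₁ (x′ , refl , Y≡) = inj₁ (x′ , refl , Y≡)
... | inj₂ (j , j≤n , G≡) = inj₂ (j , m≤n⇒m≤1+n j≤n , G≡)

prefix-of-𝟎^𝟏 : ∀ n w′ c s t → w′ ++ c ∷ s ≡ 𝟎^ n ++ 𝟏 ∷ t →
  (Σ[ i ∈ ℕ ] w′ ≡ 𝟎^ i × (i < n × c ≡ 𝟎 ⊎ i ≡ n × c ≡ 𝟏)) ⊎ (Σ[ w″ ∈ Word ] w′ ≡ 𝟎^ n ++ 𝟏 ∷ w″)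
prefix-of-𝟎^𝟏 zero [] c s t eq = inj₁ (0 , refl , inj₂ (refl , ∷-injectiveˡ eq))
prefix-of-𝟎^𝟏 zero (_ ∷ w′) c s t eq with ∷-injective eq
... | refl , _ = inj₂ (w′ , refl)
prefix-of-𝟎^𝟏 (suc n) [] c s t eq = inj₁ (0 , refl , inj₁ (s≤s z≤n , ∷-injectiveˡ eq))
prefix-of-𝟎^𝟏 (suc n) (_ ∷ w′) c s t eq with ∷-injective eq
... | refl , eq′ with prefix-of-𝟎^𝟏 n w′ c s t eq′
... | inj₁ (i , refl , inj₁ (i<n , c≡)) = inj₁ (suc i , refl , inj₁ (s≤s i<n , c≡))
... | inj₁ (i , refl , inj₂ (refl , c≡)) = inj₁ (suc i , refl , inj₂ (refl , c≡))
... | inj₂ (w″ , refl) = inj₂ (w″ , refl)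

module Morphism (p q : ℕ) (p≢q : p ≢ q) where

  Φ : Word → Word
  Φ = φ p q

  blockLength : Letter → ℕ
  blockLength 𝟎 = p
  blockLength 𝟏 = q

  φₗ-block : ∀ c → φₗ p q c ≡ 𝟎^ blockLength c ++ [ 𝟏 ]
  φₗ-block 𝟎 = refl
  φₗ-block 𝟏 = refl

  φₗ-++ : ∀ c X → φₗ p q c ++ X ≡ 𝟎^ blockLength c ++ 𝟏 ∷ X
  φₗ-++ c X = trans (cong (_++ X) (φₗ-block c)) (++-assoc (𝟎^ blockLength c) [ 𝟏 ] X)

  []≢φₗ-++ : ∀ c X → [] ≢ φₗ p q c ++ X
  []≢φₗ-++ c X eq = []≢++∷ (𝟎^ blockLength c) (trans eq (φₗ-++ c X))

  φₗ-injective : ∀ c d {X Y} → φₗ p q c ++ X ≡ φₗ p q d ++ Y → c ≡ d × X ≡ Y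
  φₗ-injective c d {X} {Y} eq
    with 𝟎^𝟏-injective (blockLength c) (blockLength d) (trans (sym (φₗ-++ c X)) (trans eq (φₗ-++ d Y)))
  φₗ-injective 𝟎 𝟎 eq | _ , X≡Y = refl , X≡Y
  φₗ-injective 𝟏 𝟏 eq | _ , X≡Y = refl , X≡Y
  φₗ-injective 𝟎 𝟏 eq | p≡q , _ = ⊥-elim (p≢q p≡q)
  φₗ-injective 𝟏 𝟎 eq | q≡p , _ = ⊥-elim (p≢q (sym q≡p))

  φ-++ : ∀ x y → Φ (x ++ y) ≡ Φ x ++ Φ y
  φ-++ x y = trans (cong concat (map-++ (φₗ p q) x y)) (sym (concat-++ (map (φₗ p q) x) (map (φₗ p q) y)))

  φ-∷ʳ : ∀ x c → Φ (x ++ [ c ]) ≡ Φ x ++ 𝟎^ blockLength c ++ [ 𝟏 ]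
  φ-∷ʳ x c = trans (φ-++ x [ c ]) (cong (Φ x ++_) (trans (++-identityʳ _) (φₗ-block c)))

  φ-emptyOrEnds𝟏 : ∀ z → EmptyOrEnds𝟏 (Φ z)
  φ-emptyOrEnds𝟏 [] = inj₁ refl
  φ-emptyOrEnds𝟏 (c ∷ z) with φ-emptyOrEnds𝟏 z
  ... | inj₁ eq = inj₂ (𝟎^ blockLength c , trans (cong (φₗ p q c ++_) eq) (trans (++-identityʳ _) (φₗ-block c)))
  ... | inj₂ (Z , eq) = inj₂ (φₗ p q c ++ Z , trans (cong (φₗ p q c ++_) eq) (sym (++-assoc _ Z [ 𝟏 ])))

  φ-head-block : ∀ z {s y} → Φ z ≡ 𝟎^ s ++ 𝟏 ∷ y → s ≡ p ⊎ s ≡ q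
  φ-head-block [] {s} eq = ⊥-elim ([]≢++∷ (𝟎^ s) eq)
  φ-head-block (c ∷ z) {s} eq with 𝟎^𝟏-injective (blockLength c) s (trans (sym (φₗ-++ c (Φ z))) eq)
  φ-head-block (𝟎 ∷ z) eq | p≡s , _ = inj₁ (sym p≡s)
  φ-head-block (𝟏 ∷ z) eq | q≡s , _ = inj₂ (sym q≡s)

  φ-split-at-𝟏 : ∀ z A {R} → Φ z ≡ A ++ 𝟏 ∷ R →
    Σ[ z₁ ∈ Word ] Σ[ c ∈ Letter ] Σ[ z₂ ∈ Word ]
      z ≡ z₁ ++ c ∷ z₂ × Φ z₁ ++ φₗ p q c ≡ A ++ [ 𝟏 ] × Φ z₂ ≡ R
  φ-split-at-𝟏 [] A eq = ⊥-elim ([]≢++∷ A eq)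
  φ-split-at-𝟏 (c ∷ z) A eq
    with split-𝟎^𝟏-++-at-𝟏 (blockLength c) A (trans (cong (_++ Φ z) (sym (φₗ-block c))) eq)
  ... | inj₁ (refl , R≡) = [] , c , z , refl , φₗ-block c , sym R≡
  ... | inj₂ (A′ , refl , eq′) with φ-split-at-𝟏 z A′ eq′
  ... | z₁ , d , z₂ , refl , head≡ , tail≡ = c ∷ z₁ , d , z₂ , refl , head≡′ , tail≡
    where
    open ≡-Reasoning
    head≡′ : Φ (c ∷ z₁) ++ φₗ p q d ≡ ((𝟎^ blockLength c ++ [ 𝟏 ]) ++ A′) ++ [ 𝟏 ]
    head≡′ = begin
      (φₗ p q c ++ Φ z₁) ++ φₗ p q d   ≡⟨ ++-assoc (φₗ p q c) (Φ z₁) (φₗ p q d) ⟩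
      φₗ p q c ++ Φ z₁ ++ φₗ p q d     ≡⟨ cong₂ _++_ (φₗ-block c) head≡ ⟩
      (𝟎^ blockLength c ++ [ 𝟏 ]) ++ A′ ++ [ 𝟏 ] ≡⟨ sym (++-assoc (𝟎^ blockLength c ++ [ 𝟏 ]) A′ [ 𝟏 ]) ⟩
      ((𝟎^ blockLength c ++ [ 𝟏 ]) ++ A′) ++ [ 𝟏 ] ∎

  φ-prefix-preimage : ∀ Y z {G} → Φ z ≡ Φ Y ++ G → Σ[ z′ ∈ Word ] z ≡ Y ++ z′ × Φ z′ ≡ G
  φ-prefix-preimage [] z eq = z , refl , eq
  φ-prefix-preimage (d ∷ Y) [] {G} eq = ⊥-elim ([]≢φₗ-++ d (Φ Y ++ G) (trans eq (++-assoc (φₗ p q d) (Φ Y) G)))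
  φ-prefix-preimage (d ∷ Y) (c ∷ z) {G} eq with φₗ-injective c d (trans eq (++-assoc (φₗ p q d) (Φ Y) G))
  ... | refl , eq′ with φ-prefix-preimage Y z eq′
  ... | z′ , refl , G≡ = z′ , refl , G≡

  φ-injective : ∀ x y → Φ x ≡ Φ y → x ≡ y
  φ-injective x y eq with φ-prefix-preimage y x (trans eq (sym (++-identityʳ (Φ y))))
  ... | [] , x≡ , _ = trans x≡ (++-identityʳ y)
  ... | d ∷ z , _ , Φdz≡[] = ⊥-elim ([]≢φₗ-++ d (Φ z) (sym Φdz≡[]))

  φ-split-after-prefix : ∀ X {Z} z → EmptyOrEnds𝟏 X → Φ z ≡ X ++ Z →
    Σ[ z₁ ∈ Word ] Σ[ z₂ ∈ Word ] z ≡ z₁ ++ z₂ × Φ z₁ ≡ X × Φ z₂ ≡ Z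
  φ-split-after-prefix _ z (inj₁ refl) Φz≡ = [] , z , refl , refl , Φz≡
  φ-split-after-prefix _ {Z} z (inj₂ (X′ , refl)) Φz≡
    with φ-split-at-𝟏 z X′ (trans Φz≡ (++-assoc X′ [ 𝟏 ] Z))
  ... | z₁ , c , z₂ , refl , Φz₁c≡ , Φz₂≡ =
    z₁ ++ [ c ] , z₂ , sym (++-assoc z₁ [ c ] z₂) ,
    trans (φ-++ z₁ [ c ]) (trans (cong (Φ z₁ ++_) (++-identityʳ _)) Φz₁c≡) , Φz₂≡

  φ-preimage-nonempty : ∀ y {X V} → Φ y ≡ X ++ 𝟏 ∷ V → 1 ≤ length y
  φ-preimage-nonempty [] {X} Φ[]≡ = ⊥-elim ([]≢++∷ X Φ[]≡)
  φ-preimage-nonempty (_ ∷ _) _ = s≤s z≤n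

module Language (p q : ℕ) (1≤q : 1 ≤ q) (q<p : q < p) where

  open Morphism p q (λ p≡q → <⇒≢ q<p (sym p≡q)) public

  L : Word → Set
  L = InL p q

  InL-infix : ∀ {Z} F x y → Z ≡ x ++ F ++ y → L Z → L F
  InL-infix F x y Z≡ (n , x₀ , y₀ , eq) = n , x₀ ++ x , y ++ y₀ ,
    trans eq (trans (cong (λ t → x₀ ++ t ++ y₀) Z≡)
      (solve 5 (λ x₀ x F y y₀ → x₀ ⊕ (x ⊕ F ⊕ y) ⊕ y₀ ⊜ (x₀ ⊕ x) ⊕ F ⊕ (y ⊕ y₀)) refl x₀ x F y y₀))

  InL-suffix : ∀ {Z} F x → Z ≡ x ++ F → L Z → L F
  InL-suffix F x Z≡ = InL-infix F x [] (trans Z≡ (cong (x ++_) (sym (++-identityʳ F))))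

  InL-prefix : ∀ {Z} F y → Z ≡ F ++ y → L Z → L F
  InL-prefix F y = InL-infix F [] y

  -- φ⁰(𝟎) = 𝟎 contains no 𝟏, so a factor containing 𝟏 lies in a φ-image.
  InL-𝟏-in-image : ∀ {F} F₁ F₂ → L F → F ≡ F₁ ++ 𝟏 ∷ F₂ →
    Σ[ n ∈ ℕ ] Σ[ x ∈ Word ] Σ[ y ∈ Word ] Φ (φ^ p q n [ 𝟎 ]) ≡ x ++ F ++ y
  InL-𝟏-in-image F₁ F₂ (zero , x , y , eq) refl = ⊥-elim (𝟎≢++𝟏 (x ++ F₁) (trans eq
      (solve 5 (λ x F₁ 𝟏 F₂ y → x ⊕ (F₁ ⊕ 𝟏 ⊕ F₂) ⊕ y ⊜ (x ⊕ F₁) ⊕ 𝟏 ⊕ (F₂ ⊕ y)) refl x F₁ [ 𝟏 ] F₂ y)))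
    where
    𝟎≢++𝟏 : ∀ U {V} → [ 𝟎 ] ≢ U ++ 𝟏 ∷ V
    𝟎≢++𝟏 [] ()
    𝟎≢++𝟏 (_ ∷ U) eq = []≢++∷ U (∷-injectiveʳ eq)
  InL-𝟏-in-image F₁ F₂ (suc n , x , y , eq) _ = n , x , y , eq

  InL-𝟏𝟎^s𝟏⇒s≡p⊎q : ∀ s → L (𝟏 ∷ 𝟎^ s ++ [ 𝟏 ]) → s ≡ p ⊎ s ≡ q
  InL-𝟏𝟎^s𝟏⇒s≡p⊎q s h with InL-𝟏-in-image [] (𝟎^ s ++ [ 𝟏 ]) h refl
  ... | n , x , y , eq
    with φ-split-at-𝟏 (φ^ p q n [ 𝟎 ]) x (trans eq (cong (λ t → x ++ 𝟏 ∷ t) (++-assoc (𝟎^ s) [ 𝟏 ] y)))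
  ... | _ , _ , z₂ , _ , _ , Φz₂≡ = φ-head-block z₂ Φz₂≡

  InL-𝟏𝟎^s𝟏⇒s≤p : ∀ s → L (𝟏 ∷ 𝟎^ s ++ [ 𝟏 ]) → s ≤ p
  InL-𝟏𝟎^s𝟏⇒s≤p s h with InL-𝟏𝟎^s𝟏⇒s≡p⊎q s h
  ... | inj₁ refl = ≤-refl
  ... | inj₂ refl = <⇒≤ q<p

  InL-𝟏𝟎^s𝟏⇒s<p⇒s≡q : ∀ s → s < p → L (𝟏 ∷ 𝟎^ s ++ [ 𝟏 ]) → s ≡ q
  InL-𝟏𝟎^s𝟏⇒s<p⇒s≡q s s<p h with InL-𝟏𝟎^s𝟏⇒s≡p⊎q s h
  ... | inj₁ refl = ⊥-elim (<-irrefl refl s<p)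
  ... | inj₂ s≡q = s≡q

  InL-𝟏𝟎^s𝟏⇒q≤s : ∀ s → L (𝟏 ∷ 𝟎^ s ++ [ 𝟏 ]) → q ≤ s
  InL-𝟏𝟎^s𝟏⇒q≤s s h with InL-𝟏𝟎^s𝟏⇒s≡p⊎q s h
  ... | inj₁ refl = <⇒≤ q<p
  ... | inj₂ refl = ≤-refl

  𝟏𝟏∉L : ¬ L (𝟏 ∷ 𝟏 ∷ [])
  𝟏𝟏∉L h with InL-𝟏𝟎^s𝟏⇒s≡p⊎q 0 h
  ... | inj₁ 0≡p = <⇒≢ (<-≤-trans (s≤s z≤n) q<p) 0≡p
  ... | inj₂ 0≡q = <⇒≢ 1≤q 0≡q

  φ-no-𝟎^1+p : ∀ z x y → Φ z ≢ x ++ 𝟎^ suc p ++ y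
  φ-no-𝟎^1+p [] x y eq = []≢++∷ x eq
  φ-no-𝟎^1+p (c ∷ z) x y eq with split-𝟎^𝟏-++ (blockLength c) x (trans (cong (_++ Φ z) (sym (φₗ-block c))) eq)
  ... | inj₁ (x′ , _ , eq′) = φ-no-𝟎^1+p z x′ y eq′
  ... | inj₂ (j , j≤ , eq′) = 𝟎^𝟏≢longer-𝟎^ j (suc p) (s≤s (≤-trans j≤ (blockLength≤p c))) (sym eq′)
    where
    blockLength≤p : ∀ c → blockLength c ≤ p
    blockLength≤p 𝟎 = ≤-refl
    blockLength≤p 𝟏 = <⇒≤ q<p

  𝟎^1+p∉L : ¬ L (𝟎^ suc p)
  𝟎^1+p∉L (zero , x , y , eq) = 𝟎≢++𝟎^1+m x (<-≤-trans (s≤s z≤n) q<p) eq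
    where
    𝟎≢++𝟎^1+m : ∀ {m} x {y} → 1 ≤ m → [ 𝟎 ] ≢ x ++ 𝟎^ suc m ++ y
    𝟎≢++𝟎^1+m {suc _} [] _ ()
    𝟎≢++𝟎^1+m (_ ∷ x) _ eq = []≢++∷ x (∷-injectiveʳ eq)
  𝟎^1+p∉L (suc n , x , y , eq) = φ-no-𝟎^1+p (φ^ p q n [ 𝟎 ]) x y eq

  InL-𝟏M𝟏⇒image : ∀ M → L (𝟏 ∷ M ++ [ 𝟏 ]) → Σ[ y ∈ Word ] Φ y ≡ M ++ [ 𝟏 ]
  InL-𝟏M𝟏⇒image M h with InL-𝟏-in-image [] (M ++ [ 𝟏 ]) h refl
  ... | n , x , y , eq
    with φ-split-at-𝟏 (φ^ p q n [ 𝟎 ]) x (trans eq (cong (λ t → x ++ 𝟏 ∷ t) (++-assoc M [ 𝟏 ] y)))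
  ... | _ , _ , z₂ , _ , _ , Φz₂≡ with φ-split-at-𝟏 z₂ M Φz₂≡
  ... | z₁ , c , _ , _ , Φz₁c≡ , _ = z₁ ++ [ c ] , trans (φ-++ z₁ [ c ]) (trans (cong (Φ z₁ ++_) (++-identityʳ _)) Φz₁c≡)

  -- In Φ z₁ φ(c), the letter before the last q zeros is 𝟏 when c = 𝟏 and 𝟎 when c = 𝟎 (as q < p).
  letter-before-𝟎^q : ∀ z c a x → Φ z ++ 𝟎^ blockLength c ≡ x ++ a ∷ 𝟎^ q → c ≡ a
  letter-before-𝟎^q z 𝟎 𝟎 x _ = refl
  letter-before-𝟎^q z 𝟏 𝟏 x _ = refl
  letter-before-𝟎^q z 𝟏 𝟎 x eq with φ-emptyOrEnds𝟏 z
                                   | ++-cancelʳ (𝟎^ q) (Φ z) (x ++ [ 𝟎 ]) (trans eq (sym (++-assoc x [ 𝟎 ] (𝟎^ q))))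
  ... | inj₁ Φz≡[] | Φz≡ = ⊥-elim ([]≢++∷ x (trans (sym Φz≡[]) Φz≡))
  ... | inj₂ (Z , Φz≡Z𝟏) | Φz≡ with ∷ʳ-injective Z x (trans (sym Φz≡Z𝟏) Φz≡)
  ... | _ , ()
  letter-before-𝟎^q z 𝟎 𝟏 x eq with m≤n⇒∃[o]m+o≡n q<p
  ... | t , 1+q+t≡p with proj₂ (∷ʳ-injective (Φ z ++ 𝟎^ t) x (++-cancelʳ (𝟎^ q) _ _ eq′))
    where
    open ≡-Reasoning
    eq′ : ((Φ z ++ 𝟎^ t) ++ [ 𝟎 ]) ++ 𝟎^ q ≡ (x ++ [ 𝟏 ]) ++ 𝟎^ q
    eq′ = begin
      ((Φ z ++ 𝟎^ t) ++ [ 𝟎 ]) ++ 𝟎^ q ≡⟨ solve 4 (λ Φz Oₜ 𝟎 O_q → ((Φz ⊕ Oₜ) ⊕ 𝟎) ⊕ O_q ⊜ Φz ⊕ ((Oₜ ⊕ 𝟎) ⊕ O_q))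
                                               refl (Φ z) (𝟎^ t) [ 𝟎 ] (𝟎^ q) ⟩
      Φ z ++ (𝟎^ t ++ [ 𝟎 ]) ++ 𝟎^ q     ≡⟨ cong (λ u → Φ z ++ u ++ 𝟎^ q) (𝟎^-∷ʳ t) ⟩
      Φ z ++ 𝟎 ∷ 𝟎^ t ++ 𝟎^ q           ≡⟨ cong (λ u → Φ z ++ 𝟎 ∷ u) (𝟎^-+ t q) ⟩
      Φ z ++ 𝟎^ (suc t + q)             ≡⟨ cong (λ n → Φ z ++ 𝟎^ n) (trans (+-comm (suc t) q) (trans (+-suc q t) 1+q+t≡p)) ⟩
      Φ z ++ 𝟎^ p                       ≡⟨ trans eq (sym (++-assoc x [ 𝟏 ] (𝟎^ q))) ⟩
      (x ++ [ 𝟏 ]) ++ 𝟎^ q              ∎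
  ... | ()

  letter-after-𝟎^q : ∀ c b {X y} → φₗ p q c ++ X ≡ 𝟎^ q ++ b ∷ y → c ≡ b
  letter-after-𝟎^q 𝟎 𝟎 _ = refl
  letter-after-𝟎^q 𝟏 𝟏 _ = refl
  letter-after-𝟎^q 𝟏 𝟎 {X} eq with ++-cancelˡ (𝟎^ q) _ _ (trans (sym (φₗ-++ 𝟏 X)) eq)
  ... | ()
  letter-after-𝟎^q 𝟎 𝟏 {X} eq = ⊥-elim (<⇒≢ q<p (sym (proj₁ (𝟎^𝟏-injective p q (trans (sym (φₗ-++ 𝟎 X)) eq)))))

  -- a 0^q 1 φ(Y) 0^q b can only be cut out of φ(z) as φ(z₁ a Y b z₄): the letters a and b
  -- are recovered from the length of the 0-runs around the 1 and after φ(Y).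
  InL-desubstitute : ∀ a b Y → L (a ∷ T p q Y ++ [ b ]) → L (a ∷ Y ++ [ b ])
  InL-desubstitute a b Y h with InL-𝟏-in-image (a ∷ 𝟎^ q) (Φ Y ++ 𝟎^ q ++ [ b ]) h
    (solve 5 (λ a O_q 𝟏 ΦY b → a ⊕ (O_q ⊕ 𝟏 ⊕ ΦY ⊕ O_q) ⊕ b ⊜ (a ⊕ O_q) ⊕ 𝟏 ⊕ ΦY ⊕ O_q ⊕ b)
      refl [ a ] (𝟎^ q) [ 𝟏 ] (Φ Y) [ b ])
  ... | n , x , y , eq with φ-split-at-𝟏 (φ^ p q n [ 𝟎 ]) (x ++ a ∷ 𝟎^ q) (trans eq
          (solve 7 (λ x a O_q 𝟏 ΦY b y → x ⊕ ((a ⊕ O_q ⊕ 𝟏 ⊕ ΦY ⊕ O_q) ⊕ b) ⊕ y ⊜ (x ⊕ a ⊕ O_q) ⊕ 𝟏 ⊕ (ΦY ⊕ O_q ⊕ b ⊕ y))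
             refl x [ a ] (𝟎^ q) [ 𝟏 ] (Φ Y) [ b ] y))
  ... | z₁ , c , z₂ , z≡ , Φz₁c≡ , Φz₂≡ with letter-before-𝟎^q z₁ c a x
          (∷ʳ-injectiveˡ (Φ z₁ ++ 𝟎^ blockLength c) (x ++ a ∷ 𝟎^ q)
             (trans (sym (trans (cong (Φ z₁ ++_) (φₗ-block c)) (sym (++-assoc (Φ z₁) (𝟎^ blockLength c) [ 𝟏 ])))) Φz₁c≡))
  ... | refl with φ-prefix-preimage Y z₂ Φz₂≡
  ... | [] , _ , Φ[]≡ = ⊥-elim ([]≢++∷ (𝟎^ q) Φ[]≡)
  ... | d ∷ z₄ , refl , Φdz₄≡ with letter-after-𝟎^q d b Φdz₄≡
  ... | refl = n , z₁ , z₄ , trans z≡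
          (solve 5 (λ z₁ a Y b z₄ → z₁ ⊕ a ⊕ (Y ⊕ b ⊕ z₄) ⊜ z₁ ⊕ (a ⊕ Y ⊕ b) ⊕ z₄) refl z₁ [ a ] Y [ b ] z₄)

  𝟏𝟎^q𝟏𝟎^q𝟏∉L : ¬ L (𝟏 ∷ 𝟎^ q ++ 𝟏 ∷ 𝟎^ q ++ [ 𝟏 ])
  𝟏𝟎^q𝟏𝟎^q𝟏∉L h = 𝟏𝟏∉L (InL-desubstitute 𝟏 𝟏 [] (subst (λ t → L (𝟏 ∷ t)) (sym (++-assoc (𝟎^ q) (𝟏 ∷ 𝟎^ q) [ 𝟏 ])) h))

  InL-𝟏𝟎^s𝟏⇒𝟎^1+s∈L⇒s≡q : ∀ s → L (𝟏 ∷ 𝟎^ s ++ [ 𝟏 ]) → L (𝟎^ suc s) → s ≡ q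
  InL-𝟏𝟎^s𝟏⇒𝟎^1+s∈L⇒s≡q s h₁ h₂ with InL-𝟏𝟎^s𝟏⇒s≡p⊎q s h₁
  ... | inj₁ refl = ⊥-elim (𝟎^1+p∉L h₂)
  ... | inj₂ s≡q = s≡q

  InL-𝟏𝟎^s𝟎⇒𝟎^1+s∈L : ∀ s → L (𝟏 ∷ 𝟎^ s ++ [ 𝟎 ]) → L (𝟎^ suc s)
  InL-𝟏𝟎^s𝟎⇒𝟎^1+s∈L s = InL-suffix (𝟎^ suc s) [ 𝟏 ] (cong (𝟏 ∷_) (𝟎^-∷ʳ s))

  rightSpecial-𝟏𝟎^r⇒r≡q : ∀ r c b → c ≢ b → L (𝟏 ∷ 𝟎^ r ++ [ c ]) → L (𝟏 ∷ 𝟎^ r ++ [ b ]) → r ≡ q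
  rightSpecial-𝟏𝟎^r⇒r≡q r 𝟏 𝟎 _ h₁ h₂ = InL-𝟏𝟎^s𝟏⇒𝟎^1+s∈L⇒s≡q r h₁ (InL-𝟏𝟎^s𝟎⇒𝟎^1+s∈L r h₂)
  rightSpecial-𝟏𝟎^r⇒r≡q r 𝟎 𝟏 _ h₁ h₂ = InL-𝟏𝟎^s𝟏⇒𝟎^1+s∈L⇒s≡q r h₂ (InL-𝟏𝟎^s𝟎⇒𝟎^1+s∈L r h₁)
  rightSpecial-𝟏𝟎^r⇒r≡q r 𝟎 𝟎 c≢b _ _ = ⊥-elim (c≢b refl)
  rightSpecial-𝟏𝟎^r⇒r≡q r 𝟏 𝟏 c≢b _ _ = ⊥-elim (c≢b refl)

  -- The zero runs at both ends of y have length q, so 1y1y1 contains 1 0^q 1 0^q 1.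
  𝟎y𝟏-𝟏y𝟎-𝟏y𝟏y𝟏∉L : ∀ y → L (𝟎 ∷ y ++ [ 𝟏 ]) → L (𝟏 ∷ y ++ [ 𝟎 ]) → ¬ L (𝟏 ∷ y ++ 𝟏 ∷ y ++ [ 𝟏 ])
  𝟎y𝟏-𝟏y𝟎-𝟏y𝟏y𝟏∉L y 𝟎y𝟏 𝟏y𝟎 𝟏y𝟏y𝟏 with count𝟏 y in count≡
  ... | zero with count𝟏≡0⇒𝟎^ y count≡
  ...   | t , refl = 𝟏𝟎^q𝟏𝟎^q𝟏∉L (subst (λ n → L (𝟏 ∷ 𝟎^ n ++ 𝟏 ∷ 𝟎^ n ++ [ 𝟏 ])) t≡q 𝟏y𝟏y𝟏)
    where
    𝟏y𝟏 : L (𝟏 ∷ 𝟎^ t ++ [ 𝟏 ])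
    𝟏y𝟏 = InL-prefix _ (𝟎^ t ++ [ 𝟏 ]) (cong (𝟏 ∷_) (sym (++-assoc (𝟎^ t) [ 𝟏 ] (𝟎^ t ++ [ 𝟏 ])))) 𝟏y𝟏y𝟏
    t≡q : t ≡ q
    t≡q = rightSpecial-𝟏𝟎^r⇒r≡q t 𝟏 𝟎 (λ ()) 𝟏y𝟏 𝟏y𝟎
  𝟎y𝟏-𝟏y𝟎-𝟏y𝟏y𝟏∉L y 𝟎y𝟏 𝟏y𝟎 𝟏y𝟏y𝟏 | suc _ with first𝟏 y count≡ | last𝟏 y count≡
  ... | s , R , y≡𝟎^s𝟏R , _ | P , e , y≡P𝟏𝟎^e =
    𝟏𝟎^q𝟏𝟎^q𝟏∉L (subst₂ (λ e s → L (𝟏 ∷ 𝟎^ e ++ 𝟏 ∷ 𝟎^ s ++ [ 𝟏 ])) e≡q s≡q 𝟏𝟎^e𝟏𝟎^s𝟏)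
    where
    𝟏y𝟏 : L (𝟏 ∷ y ++ [ 𝟏 ])
    𝟏y𝟏 = InL-prefix _ (y ++ [ 𝟏 ]) (cong (𝟏 ∷_) (sym (++-assoc y [ 𝟏 ] (y ++ [ 𝟏 ])))) 𝟏y𝟏y𝟏
    s≡q : s ≡ q
    s≡q = InL-𝟏𝟎^s𝟏⇒𝟎^1+s∈L⇒s≡q s
      (InL-prefix _ (R ++ [ 𝟏 ]) (trans (cong (λ u → 𝟏 ∷ u ++ [ 𝟏 ]) y≡𝟎^s𝟏R)
        (solve 3 (λ O_s 𝟏 R → 𝟏 ⊕ (O_s ⊕ 𝟏 ⊕ R) ⊕ 𝟏 ⊜ (𝟏 ⊕ O_s ⊕ 𝟏) ⊕ R ⊕ 𝟏) refl (𝟎^ s) [ 𝟏 ] R)) 𝟏y𝟏)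
      (InL-prefix _ (𝟏 ∷ R ++ [ 𝟏 ])
        (trans (cong (λ u → 𝟎 ∷ u ++ [ 𝟏 ]) y≡𝟎^s𝟏R) (cong (𝟎 ∷_) (++-assoc (𝟎^ s) (𝟏 ∷ R) [ 𝟏 ]))) 𝟎y𝟏)
    e≡q : e ≡ q
    e≡q = rightSpecial-𝟏𝟎^r⇒r≡q e 𝟏 𝟎 (λ ())
      (InL-suffix _ (𝟏 ∷ P) (trans (cong (λ u → 𝟏 ∷ u ++ [ 𝟏 ]) y≡P𝟏𝟎^e)
        (solve 3 (λ P 𝟏 O_e → 𝟏 ⊕ (P ⊕ 𝟏 ⊕ O_e) ⊕ 𝟏 ⊜ (𝟏 ⊕ P) ⊕ 𝟏 ⊕ O_e ⊕ 𝟏) refl P [ 𝟏 ] (𝟎^ e))) 𝟏y𝟏)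
      (InL-suffix _ (𝟏 ∷ P) (trans (cong (λ u → 𝟏 ∷ u ++ [ 𝟎 ]) y≡P𝟏𝟎^e)
        (solve 4 (λ P 𝟏 O_e 𝟎 → 𝟏 ⊕ (P ⊕ 𝟏 ⊕ O_e) ⊕ 𝟎 ⊜ (𝟏 ⊕ P) ⊕ 𝟏 ⊕ O_e ⊕ 𝟎) refl P [ 𝟏 ] (𝟎^ e) [ 𝟎 ])) 𝟏y𝟎)
    𝟏𝟎^e𝟏𝟎^s𝟏 : L (𝟏 ∷ 𝟎^ e ++ 𝟏 ∷ 𝟎^ s ++ [ 𝟏 ])
    𝟏𝟎^e𝟏𝟎^s𝟏 = InL-infix _ (𝟏 ∷ P) (R ++ [ 𝟏 ]) (begin
      𝟏 ∷ y ++ 𝟏 ∷ y ++ [ 𝟏 ]                 ≡⟨ cong₂ (λ u v → 𝟏 ∷ u ++ 𝟏 ∷ v ++ [ 𝟏 ]) y≡P𝟏𝟎^e y≡𝟎^s𝟏R ⟩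
      𝟏 ∷ (P ++ 𝟏 ∷ 𝟎^ e) ++ 𝟏 ∷ (𝟎^ s ++ 𝟏 ∷ R) ++ [ 𝟏 ]
        ≡⟨ solve 5 (λ P 𝟏 O_e O_s R → 𝟏 ⊕ (P ⊕ 𝟏 ⊕ O_e) ⊕ 𝟏 ⊕ (O_s ⊕ 𝟏 ⊕ R) ⊕ 𝟏 ⊜ (𝟏 ⊕ P) ⊕ (𝟏 ⊕ O_e ⊕ 𝟏 ⊕ O_s ⊕ 𝟏) ⊕ R ⊕ 𝟏)
             refl P [ 𝟏 ] (𝟎^ e) (𝟎^ s) R ⟩
      (𝟏 ∷ P) ++ (𝟏 ∷ 𝟎^ e ++ 𝟏 ∷ 𝟎^ s ++ [ 𝟏 ]) ++ R ++ [ 𝟏 ] ∎) 𝟏y𝟏y𝟏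
      where open ≡-Reasoning

  𝟎[y𝟏]ᵏy𝟎∉L : ∀ y J → ¬ L (𝟎 ∷ ((y ++ [ 𝟏 ]) ^ʷ (3 + J) ++ y) ++ [ 𝟎 ])
  𝟎[y𝟏]ᵏy𝟎∉L y J h = 𝟎y𝟏-𝟏y𝟎-𝟏y𝟏y𝟏∉L y 𝟎y𝟏 𝟏y𝟎 𝟏y𝟏y𝟏
    where
    Uᴶ = (y ++ [ 𝟏 ]) ^ʷ J
    𝟎y𝟏 : L (𝟎 ∷ y ++ [ 𝟏 ])
    𝟎y𝟏 = InL-prefix _ ((y ++ [ 𝟏 ]) ++ (y ++ [ 𝟏 ]) ++ Uᴶ ++ y ++ [ 𝟎 ])
      (solve 4 (λ 𝟎 y 𝟏 Uᴶ → 𝟎 ⊕ (((y ⊕ 𝟏) ⊕ (y ⊕ 𝟏) ⊕ (y ⊕ 𝟏) ⊕ Uᴶ) ⊕ y) ⊕ 𝟎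
        ⊜ (𝟎 ⊕ y ⊕ 𝟏) ⊕ ((y ⊕ 𝟏) ⊕ (y ⊕ 𝟏) ⊕ Uᴶ ⊕ y ⊕ 𝟎)) refl [ 𝟎 ] y [ 𝟏 ] Uᴶ) h
    𝟏y𝟏y𝟏 : L (𝟏 ∷ y ++ 𝟏 ∷ y ++ [ 𝟏 ])
    𝟏y𝟏y𝟏 = InL-infix _ (𝟎 ∷ y) (Uᴶ ++ y ++ [ 𝟎 ])
      (solve 4 (λ 𝟎 y 𝟏 Uᴶ → 𝟎 ⊕ (((y ⊕ 𝟏) ⊕ (y ⊕ 𝟏) ⊕ (y ⊕ 𝟏) ⊕ Uᴶ) ⊕ y) ⊕ 𝟎
        ⊜ (𝟎 ⊕ y) ⊕ (𝟏 ⊕ y ⊕ 𝟏 ⊕ y ⊕ 𝟏) ⊕ (Uᴶ ⊕ y ⊕ 𝟎)) refl [ 𝟎 ] y [ 𝟏 ] Uᴶ) h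
    𝟏y𝟎 : L (𝟏 ∷ y ++ [ 𝟎 ])
    𝟏y𝟎 = InL-suffix _ (𝟎 ∷ (y ++ [ 𝟏 ]) ^ʷ (2 + J) ++ y)
      (trans (cong (λ t → 𝟎 ∷ (t ++ y) ++ [ 𝟎 ]) (^ʷ-sucʳ (y ++ [ 𝟏 ]) (2 + J)))
        (solve 4 (λ 𝟎 y 𝟏 U² → 𝟎 ⊕ ((U² ⊕ (y ⊕ 𝟏)) ⊕ y) ⊕ 𝟎 ⊜ (𝟎 ⊕ U² ⊕ y) ⊕ (𝟏 ⊕ y ⊕ 𝟎))
          refl [ 𝟎 ] y [ 𝟏 ] ((y ++ [ 𝟏 ]) ^ʷ (2 + J)))) h

  -- y = 0^s 1 ⋯ 1 0^e with q ≤ s, q ≤ e, while y0y contains the gap 1 0^(e+1+s) 1.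
  𝟏y-y𝟏-y𝟎y∈L⇒q+q<p : ∀ y {n} → count𝟏 y ≡ suc n →
    L (𝟏 ∷ y) → L (y ++ [ 𝟏 ]) → L (y ++ 𝟎 ∷ y) → q + q < p
  𝟏y-y𝟏-y𝟎y∈L⇒q+q<p y count≡ 𝟏y y𝟏 y𝟎y with first𝟏 y count≡ | last𝟏 y count≡
  ... | s , R , y≡𝟎^s𝟏R , _ | P , e , y≡P𝟏𝟎^e =
    ≤-trans (s≤s (+-mono-≤ q≤e q≤s)) (≤-trans (≤-reflexive (sym (+-suc e s))) (InL-𝟏𝟎^s𝟏⇒s≤p _ 𝟏𝟎^[e+1+s]𝟏))
    where
    q≤s : q ≤ s
    q≤s = InL-𝟏𝟎^s𝟏⇒q≤s s (InL-prefix _ R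
      (trans (cong (𝟏 ∷_) y≡𝟎^s𝟏R) (cong (𝟏 ∷_) (sym (++-assoc (𝟎^ s) [ 𝟏 ] R)))) 𝟏y)
    q≤e : q ≤ e
    q≤e = InL-𝟏𝟎^s𝟏⇒q≤s e (InL-suffix _ P
      (trans (cong (_++ [ 𝟏 ]) y≡P𝟏𝟎^e) (++-assoc P (𝟏 ∷ 𝟎^ e) [ 𝟏 ])) y𝟏)
    𝟏𝟎^[e+1+s]𝟏 : L (𝟏 ∷ 𝟎^ (e + suc s) ++ [ 𝟏 ])
    𝟏𝟎^[e+1+s]𝟏 = InL-infix _ P R (begin
      y ++ 𝟎 ∷ y                                  ≡⟨ cong₂ (λ u v → u ++ 𝟎 ∷ v) y≡P𝟏𝟎^e y≡𝟎^s𝟏R ⟩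
      (P ++ 𝟏 ∷ 𝟎^ e) ++ 𝟎 ∷ 𝟎^ s ++ 𝟏 ∷ R
        ≡⟨ solve 6 (λ P 𝟏 O_e 𝟎 O_s R → (P ⊕ 𝟏 ⊕ O_e) ⊕ 𝟎 ⊕ O_s ⊕ 𝟏 ⊕ R ⊜ P ⊕ (𝟏 ⊕ O_e ⊕ 𝟎 ⊕ O_s ⊕ 𝟏) ⊕ R)
             refl P [ 𝟏 ] (𝟎^ e) [ 𝟎 ] (𝟎^ s) R ⟩
      P ++ (𝟏 ∷ 𝟎^ e ++ 𝟎 ∷ 𝟎^ s ++ [ 𝟏 ]) ++ R   ≡⟨ cong (λ u → P ++ (𝟏 ∷ u) ++ R)
                                                       (trans (sym (++-assoc (𝟎^ e) (𝟎^ suc s) [ 𝟏 ])) (cong (_++ [ 𝟏 ]) (𝟎^-+ e (suc s)))) ⟩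
      P ++ (𝟏 ∷ 𝟎^ (e + suc s) ++ [ 𝟏 ]) ++ R     ∎) y𝟎y
      where open ≡-Reasoning

  𝟏[y𝟎]ᵏy𝟏∉L : ∀ y J → 1 ≤ length y → p ≤ 3 + J → p ≤ q + q →
    ¬ L (𝟏 ∷ ((y ++ [ 𝟎 ]) ^ʷ (2 + J) ++ y) ++ [ 𝟏 ])
  𝟏[y𝟎]ᵏy𝟏∉L y J 1≤|y| p≤3+J p≤q+q h with count𝟏 y in count≡
  ... | suc _ = <⇒≱ (𝟏y-y𝟏-y𝟎y∈L⇒q+q<p y count≡ 𝟏y y𝟏 y𝟎y) p≤q+q
    where
    Uᴶ = (y ++ [ 𝟎 ]) ^ʷ J
    𝟏y : L (𝟏 ∷ y)
    𝟏y = InL-prefix _ ([ 𝟎 ] ++ (y ++ [ 𝟎 ]) ++ Uᴶ ++ y ++ [ 𝟏 ])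
      (solve 4 (λ 𝟎 y 𝟏 Uᴶ → 𝟏 ⊕ (((y ⊕ 𝟎) ⊕ (y ⊕ 𝟎) ⊕ Uᴶ) ⊕ y) ⊕ 𝟏
        ⊜ (𝟏 ⊕ y) ⊕ (𝟎 ⊕ (y ⊕ 𝟎) ⊕ Uᴶ ⊕ y ⊕ 𝟏)) refl [ 𝟎 ] y [ 𝟏 ] Uᴶ) h
    y𝟏 : L (y ++ [ 𝟏 ])
    y𝟏 = InL-suffix _ (𝟏 ∷ (y ++ [ 𝟎 ]) ++ (y ++ [ 𝟎 ]) ++ Uᴶ)
      (solve 4 (λ 𝟎 y 𝟏 Uᴶ → 𝟏 ⊕ (((y ⊕ 𝟎) ⊕ (y ⊕ 𝟎) ⊕ Uᴶ) ⊕ y) ⊕ 𝟏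
        ⊜ (𝟏 ⊕ ((y ⊕ 𝟎) ⊕ (y ⊕ 𝟎) ⊕ Uᴶ)) ⊕ (y ⊕ 𝟏)) refl [ 𝟎 ] y [ 𝟏 ] Uᴶ) h
    y𝟎y : L (y ++ 𝟎 ∷ y)
    y𝟎y = InL-infix _ [ 𝟏 ] ([ 𝟎 ] ++ Uᴶ ++ y ++ [ 𝟏 ])
      (solve 4 (λ 𝟎 y 𝟏 Uᴶ → 𝟏 ⊕ (((y ⊕ 𝟎) ⊕ (y ⊕ 𝟎) ⊕ Uᴶ) ⊕ y) ⊕ 𝟏
        ⊜ 𝟏 ⊕ (y ⊕ 𝟎 ⊕ y) ⊕ (𝟎 ⊕ Uᴶ ⊕ y ⊕ 𝟏)) refl [ 𝟎 ] y [ 𝟏 ] Uᴶ) h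
  ... | zero with count𝟏≡0⇒𝟎^ y count≡
  ...   | suc t , refl = <⇒≱ p<gap (InL-𝟏𝟎^s𝟏⇒s≤p _ (subst (λ u → L (𝟏 ∷ u ++ [ 𝟏 ])) h≡ h))
    where
    open ≤-Reasoning
    h≡ : (𝟎^ suc t ++ [ 𝟎 ]) ^ʷ (2 + J) ++ 𝟎^ suc t ≡ 𝟎^ ((2 + J) * suc (suc t) + suc t)
    h≡ = trans (cong (λ u → u ^ʷ (2 + J) ++ 𝟎^ suc t) (𝟎^-∷ʳ (suc t)))
           (trans (cong (_++ 𝟎^ suc t) (𝟎^-^ʷ (2 + J) (suc (suc t)))) (𝟎^-+ ((2 + J) * suc (suc t)) (suc t)))
    p<gap : p < (2 + J) * suc (suc t) + suc t
    p<gap = begin-strict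
      p                              ≤⟨ p≤3+J ⟩
      3 + J                          <⟨ s≤s (s≤s (s≤s (s≤s (≤-trans (m≤m*n J 2) (m≤m+n (J * 2) 1))))) ⟩
      (2 + J) * 2 + 1                 ≤⟨ +-mono-≤ (*-monoʳ-≤ (2 + J) (s≤s (s≤s z≤n))) (s≤s z≤n) ⟩
      (2 + J) * suc (suc t) + suc t  ∎
  ...   | zero , refl with 1≤|y|
  ...     | ()

module Desubstitution (p q : ℕ) (1≤q : 1 ≤ q) (q<p : q < p) where

  open Language p q 1≤q q<p public

  -- w = 0^q 1 φ(w̃) (0^q 1)⁻¹, stated without the inverse.
  ConjugateImage : Word → Word → Set
  ConjugateImage w w̃ = w ++ 𝟎^ q ++ [ 𝟏 ] ≡ 𝟎^ q ++ 𝟏 ∷ Φ w̃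

  ConjugateImage-^ʷ : ∀ w w̃ → ConjugateImage w w̃ → ∀ n → ConjugateImage (w ^ʷ n) (w̃ ^ʷ n)
  ConjugateImage-^ʷ w w̃ conj zero = refl
  ConjugateImage-^ʷ w w̃ conj (suc n) = begin
    (w ++ w ^ʷ n) ++ 𝟎^ q ++ [ 𝟏 ]       ≡⟨ ++-assoc w (w ^ʷ n) _ ⟩
    w ++ w ^ʷ n ++ 𝟎^ q ++ [ 𝟏 ]         ≡⟨ cong (w ++_) (ConjugateImage-^ʷ w w̃ conj n) ⟩
    w ++ 𝟎^ q ++ 𝟏 ∷ Φ (w̃ ^ʷ n)          ≡⟨ sym (++-assoc w (𝟎^ q) (𝟏 ∷ Φ (w̃ ^ʷ n))) ⟩
    (w ++ 𝟎^ q) ++ 𝟏 ∷ Φ (w̃ ^ʷ n)        ≡⟨ sym (++-assoc (w ++ 𝟎^ q) [ 𝟏 ] (Φ (w̃ ^ʷ n))) ⟩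
    ((w ++ 𝟎^ q) ++ [ 𝟏 ]) ++ Φ (w̃ ^ʷ n) ≡⟨ cong (_++ Φ (w̃ ^ʷ n)) (trans (++-assoc w (𝟎^ q) [ 𝟏 ]) conj) ⟩
    (𝟎^ q ++ 𝟏 ∷ Φ w̃) ++ Φ (w̃ ^ʷ n)      ≡⟨ ++-assoc (𝟎^ q) (𝟏 ∷ Φ w̃) (Φ (w̃ ^ʷ n)) ⟩
    𝟎^ q ++ 𝟏 ∷ Φ w̃ ++ Φ (w̃ ^ʷ n)        ≡⟨ cong (λ u → 𝟎^ q ++ 𝟏 ∷ u) (sym (φ-++ w̃ (w̃ ^ʷ n))) ⟩
    𝟎^ q ++ 𝟏 ∷ Φ (w̃ ^ʷ suc n)           ∎
    where open ≡-Reasoning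

  T-injective : ∀ Y Y′ → T p q Y ≡ T p q Y′ → Y ≡ Y′
  T-injective Y Y′ eq = φ-injective Y Y′ (++-cancelʳ (𝟎^ q) _ _ (∷-injectiveʳ (++-cancelˡ (𝟎^ q) _ _ eq)))

  desubstitution-unique : ∀ {w w′ k w̃ w̃′ u u′} →
    ConjugateImage w w̃ → w ^ʷ k ++ w′ ≡ T p q (w̃ ^ʷ k ++ w̃′) →
    ConjugateImage w u → w ^ʷ k ++ w′ ≡ T p q (u ^ʷ k ++ u′) → u ≡ w̃ × u′ ≡ w̃′
  desubstitution-unique {k = k} {w̃} {w̃′} {u} {u′} conj v≡ conjᵤ v≡ᵤ
    with φ-injective u w̃ (∷-injectiveʳ (++-cancelˡ (𝟎^ q) _ _ (trans (sym conjᵤ) conj)))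
  ... | refl = refl , ++-cancelˡ (w̃ ^ʷ k) u′ w̃′ (T-injective _ _ (trans (sym v≡ᵤ) v≡))

  ConjugateImage-^ʷ-𝟎^q : ∀ w y c → ConjugateImage w (y ++ [ c ]) → ∀ K →
    w ^ʷ suc K ++ 𝟎^ q ≡ 𝟎^ q ++ 𝟏 ∷ Φ ((y ++ [ c ]) ^ʷ K ++ y) ++ 𝟎^ blockLength c
  ConjugateImage-^ʷ-𝟎^q w y c conj K = ∷ʳ-injectiveˡ (w ^ʷ suc K ++ 𝟎^ q) (𝟎^ q ++ 𝟏 ∷ Φ Y ++ 𝟎^ blockLength c) (begin
      (w ^ʷ suc K ++ 𝟎^ q) ++ [ 𝟏 ]  ≡⟨ ++-assoc (w ^ʷ suc K) (𝟎^ q) [ 𝟏 ] ⟩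
      w ^ʷ suc K ++ 𝟎^ q ++ [ 𝟏 ]    ≡⟨ ConjugateImage-^ʷ w w̃ conj (suc K) ⟩
      𝟎^ q ++ 𝟏 ∷ Φ (w̃ ^ʷ suc K)     ≡⟨ cong (λ u → 𝟎^ q ++ 𝟏 ∷ Φ u) (trans (^ʷ-sucʳ w̃ K) (sym (++-assoc (w̃ ^ʷ K) y [ c ]))) ⟩
      𝟎^ q ++ 𝟏 ∷ Φ (Y ++ [ c ])     ≡⟨ cong (λ u → 𝟎^ q ++ 𝟏 ∷ u) (φ-∷ʳ Y c) ⟩
      𝟎^ q ++ 𝟏 ∷ Φ Y ++ 𝟎^ blockLength c ++ [ 𝟏 ]
        ≡⟨ solve 4 (λ O_q 𝟏 ΦY Oc → O_q ⊕ 𝟏 ⊕ ΦY ⊕ Oc ⊕ 𝟏 ⊜ (O_q ⊕ 𝟏 ⊕ ΦY ⊕ Oc) ⊕ 𝟏) refl (𝟎^ q) [ 𝟏 ] (Φ Y) (𝟎^ blockLength c) ⟩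
      (𝟎^ q ++ 𝟏 ∷ Φ Y ++ 𝟎^ blockLength c) ++ [ 𝟏 ] ∎)
    where
    open ≡-Reasoning
    w̃ = y ++ [ c ]
    Y = w̃ ^ʷ K ++ y

  framed : ℕ → Word → ℕ → Word
  framed j mid m = 𝟎^ j ++ 𝟏 ∷ mid ++ 𝟏 ∷ 𝟎^ m

  -- Borders a m: the letter a preceding w forces w to end with 1 0^m, m = 0 if a = 0 and m + q = p if a = 1.
  data Borders : Letter → ℕ → Set where
    ends𝟏 : Borders 𝟎 0
    ends𝟎 : ∀ m → suc m + q ≡ p → Borders 𝟏 (suc m)

  InL-framed²⇒junction : ∀ j mid m → L (framed j mid m ++ framed j mid m) → L (𝟏 ∷ 𝟎^ (m + j) ++ [ 𝟏 ])
  InL-framed²⇒junction j mid m ww = InL-infix _ (𝟎^ j ++ 𝟏 ∷ mid) (mid ++ 𝟏 ∷ 𝟎^ m) (begin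
      framed j mid m ++ framed j mid m
        ≡⟨ solve 4 (λ O_j 𝟏 mid O_m → (O_j ⊕ 𝟏 ⊕ mid ⊕ 𝟏 ⊕ O_m) ⊕ (O_j ⊕ 𝟏 ⊕ mid ⊕ 𝟏 ⊕ O_m)
                ⊜ (O_j ⊕ 𝟏 ⊕ mid) ⊕ (𝟏 ⊕ (O_m ⊕ O_j) ⊕ 𝟏) ⊕ (mid ⊕ 𝟏 ⊕ O_m)) refl (𝟎^ j) [ 𝟏 ] mid (𝟎^ m) ⟩
      (𝟎^ j ++ 𝟏 ∷ mid) ++ (𝟏 ∷ (𝟎^ m ++ 𝟎^ j) ++ [ 𝟏 ]) ++ (mid ++ 𝟏 ∷ 𝟎^ m)
        ≡⟨ cong (λ u → (𝟎^ j ++ 𝟏 ∷ mid) ++ (𝟏 ∷ u ++ [ 𝟏 ]) ++ (mid ++ 𝟏 ∷ 𝟎^ m)) (𝟎^-+ m j) ⟩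
      (𝟎^ j ++ 𝟏 ∷ mid) ++ (𝟏 ∷ 𝟎^ (m + j) ++ [ 𝟏 ]) ++ (mid ++ 𝟏 ∷ 𝟎^ m) ∎) ww
    where open ≡-Reasoning

  InL-a-framed⇒a𝟎^j𝟏 : ∀ a j mid m → L (a ∷ framed j mid m) → L (a ∷ 𝟎^ j ++ [ 𝟏 ])
  InL-a-framed⇒a𝟎^j𝟏 a j mid m = InL-prefix _ (mid ++ 𝟏 ∷ 𝟎^ m)
    (solve 5 (λ a O_j 𝟏 mid O_m → a ⊕ O_j ⊕ 𝟏 ⊕ mid ⊕ 𝟏 ⊕ O_m ⊜ (a ⊕ O_j ⊕ 𝟏) ⊕ (mid ⊕ 𝟏 ⊕ O_m))
      refl [ a ] (𝟎^ j) [ 𝟏 ] mid (𝟎^ m))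

  gaps⇒j≡q : ∀ j m → j ≡ p ⊎ j ≡ q → suc m + j ≡ p ⊎ suc m + j ≡ q → j ≡ q × suc m + q ≡ p
  gaps⇒j≡q j m (inj₂ refl) (inj₁ 1+m+q≡p) = refl , 1+m+q≡p
  gaps⇒j≡q j m (inj₂ refl) (inj₂ 1+m+q≡q) = ⊥-elim (m≢1+n+m q (sym 1+m+q≡q))
  gaps⇒j≡q j m (inj₁ refl) (inj₁ 1+m+p≡p) = ⊥-elim (m≢1+n+m p (sym 1+m+p≡p))
  gaps⇒j≡q j m (inj₁ refl) (inj₂ 1+m+p≡q) = ⊥-elim (<⇒≱ q<p (subst (p ≤_) 1+m+p≡q (m≤n+m p (suc m))))

  borders : ∀ a j mid m → L (framed j mid m ++ framed j mid m) → L (a ∷ framed j mid m) →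
    ¬ IsSuffix [ a ] (framed j mid m) → j ≡ q × Borders a m
  borders 𝟎 j mid (suc m) _ _ a⋣w = ⊥-elim (a⋣w (framed j mid m ,
    trans (cong (λ u → 𝟎^ j ++ 𝟏 ∷ mid ++ 𝟏 ∷ u) (sym (𝟎^-∷ʳ m)))
      (solve 5 (λ O_j 𝟏 mid O_m 𝟎 → O_j ⊕ 𝟏 ⊕ mid ⊕ 𝟏 ⊕ O_m ⊕ 𝟎 ⊜ (O_j ⊕ 𝟏 ⊕ mid ⊕ 𝟏 ⊕ O_m) ⊕ 𝟎)
        refl (𝟎^ j) [ 𝟏 ] mid (𝟎^ m) [ 𝟎 ])))
  borders 𝟏 j mid zero _ _ a⋣w = ⊥-elim (a⋣w (𝟎^ j ++ 𝟏 ∷ mid ,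
    solve 3 (λ O_j 𝟏 mid → O_j ⊕ 𝟏 ⊕ mid ⊕ 𝟏 ⊜ (O_j ⊕ 𝟏 ⊕ mid) ⊕ 𝟏) refl (𝟎^ j) [ 𝟏 ] mid))
  borders 𝟎 j mid zero ww aw _ =
    InL-𝟏𝟎^s𝟏⇒𝟎^1+s∈L⇒s≡q j (InL-framed²⇒junction j mid 0 ww) (InL-prefix _ [ 𝟏 ] refl (InL-a-framed⇒a𝟎^j𝟏 𝟎 j mid 0 aw)) ,
    ends𝟏
  borders 𝟏 j mid (suc m) ww aw _ = map₂ (ends𝟎 m)
    (gaps⇒j≡q j m (InL-𝟏𝟎^s𝟏⇒s≡p⊎q j (InL-a-framed⇒a𝟎^j𝟏 𝟏 j mid (suc m) aw))
                  (InL-𝟏𝟎^s𝟏⇒s≡p⊎q (suc m + j) (InL-framed²⇒junction j mid (suc m) ww)))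

  lastLetter : ∀ {a m} → Borders a m → Letter
  lastLetter ends𝟏 = 𝟏
  lastLetter (ends𝟎 _ _) = 𝟎

  borders-blockLength : ∀ {a m} (bd : Borders a m) → m + q ≡ blockLength (lastLetter bd)
  borders-blockLength ends𝟏 = refl
  borders-blockLength (ends𝟎 _ 1+m+q≡p) = 1+m+q≡p

  a⋣lastLetter : ∀ {a m} (bd : Borders a m) y → ¬ IsSuffix [ a ] (y ++ [ lastLetter bd ])
  a⋣lastLetter ends𝟏 y (s , eq) with ∷ʳ-injective y s eq
  ... | _ , ()
  a⋣lastLetter (ends𝟎 _ _) y (s , eq) with ∷ʳ-injective y s eq
  ... | _ , ()

  ConjugateImage-framed : ∀ {a m} (bd : Borders a m) mid y → Φ y ≡ mid ++ [ 𝟏 ] →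
    ConjugateImage (framed q mid m) (y ++ [ lastLetter bd ])
  ConjugateImage-framed {m = m} bd mid y Φy≡ = begin
      framed q mid m ++ 𝟎^ q ++ [ 𝟏 ]
        ≡⟨ solve 5 (λ O_q 𝟏 mid O_m O_q′ → (O_q ⊕ 𝟏 ⊕ mid ⊕ 𝟏 ⊕ O_m) ⊕ O_q′ ⊕ 𝟏 ⊜ O_q ⊕ 𝟏 ⊕ (mid ⊕ 𝟏) ⊕ (O_m ⊕ O_q′) ⊕ 𝟏)
             refl (𝟎^ q) [ 𝟏 ] mid (𝟎^ m) (𝟎^ q) ⟩
      𝟎^ q ++ 𝟏 ∷ (mid ++ [ 𝟏 ]) ++ (𝟎^ m ++ 𝟎^ q) ++ [ 𝟏 ]
        ≡⟨ cong₂ (λ u v → 𝟎^ q ++ 𝟏 ∷ u ++ v ++ [ 𝟏 ]) (sym Φy≡) (trans (𝟎^-+ m q) (cong 𝟎^_ (borders-blockLength bd))) ⟩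
      𝟎^ q ++ 𝟏 ∷ Φ y ++ 𝟎^ blockLength (lastLetter bd) ++ [ 𝟏 ]
        ≡⟨ cong (λ u → 𝟎^ q ++ 𝟏 ∷ u) (sym (φ-∷ʳ y (lastLetter bd))) ⟩
      𝟎^ q ++ 𝟏 ∷ Φ (y ++ [ lastLetter bd ]) ∎
    where open ≡-Reasoning

  -- The run 1 0^r ending w′ is followed by c in w and by b ≠ c in v b.
  trailing-𝟎s-of-prefix≡q : ∀ {w X r c s′ a b} k → let w′ = 𝟎^ q ++ 𝟏 ∷ X ++ 𝟎^ r in
    w ≡ w′ ++ c ∷ s′ → EmptyOrEnds𝟏 X → L w → L (a ∷ (w ^ʷ k ++ w′) ++ [ b ]) → c ≢ b → r ≡ q
  trailing-𝟎s-of-prefix≡q {X = X} {r} {c} {s′} {a} {b} k refl X-ends w∈L avb∈L c≢b with 𝟏∷-emptyOrEnds𝟏 X-ends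
  ... | P , 𝟏X≡P𝟏 = rightSpecial-𝟏𝟎^r⇒r≡q r c b c≢b
      (InL-infix _ (𝟎^ q ++ P) s′ (trans (cong (_++ c ∷ s′) w′≡)
        (solve 5 (λ Pre 𝟏 O_r c s′ → (Pre ⊕ 𝟏 ⊕ O_r) ⊕ c ⊕ s′ ⊜ Pre ⊕ (𝟏 ⊕ O_r ⊕ c) ⊕ s′)
          refl (𝟎^ q ++ P) [ 𝟏 ] (𝟎^ r) [ c ] s′)) w∈L)
      (InL-suffix _ (a ∷ w ^ʷ k ++ 𝟎^ q ++ P) (trans (cong (λ u → a ∷ (w ^ʷ k ++ u) ++ [ b ]) w′≡)
        (solve 6 (λ a wᵏ Pre 𝟏 O_r b → a ⊕ (wᵏ ⊕ Pre ⊕ 𝟏 ⊕ O_r) ⊕ b ⊜ (a ⊕ wᵏ ⊕ Pre) ⊕ 𝟏 ⊕ O_r ⊕ b)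
          refl [ a ] (w ^ʷ k) (𝟎^ q ++ P) [ 𝟏 ] (𝟎^ r) [ b ])) avb∈L)
    where
    w = (𝟎^ q ++ 𝟏 ∷ X ++ 𝟎^ r) ++ c ∷ s′
    w′≡ : 𝟎^ q ++ 𝟏 ∷ X ++ 𝟎^ r ≡ (𝟎^ q ++ P) ++ 𝟏 ∷ 𝟎^ r
    w′≡ = trans (cong (λ u → 𝟎^ q ++ u ++ 𝟎^ r) 𝟏X≡P𝟏)
      (solve 4 (λ O_q P 𝟏 O_r → O_q ⊕ (P ⊕ 𝟏) ⊕ O_r ⊜ (O_q ⊕ P) ⊕ 𝟏 ⊕ O_r) refl (𝟎^ q) P [ 𝟏 ] (𝟎^ r))

  long-prefix-desubstitution : ∀ {w w̃ X r c s′} k → let w′ = 𝟎^ q ++ 𝟏 ∷ X ++ 𝟎^ r in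
    r ≡ q → w ≡ w′ ++ c ∷ s′ → EmptyOrEnds𝟏 X → ConjugateImage w w̃ →
    Σ[ w̃′ ∈ Word ] IsProperPrefix w̃′ w̃ × w ^ʷ k ++ w′ ≡ T p q (w̃ ^ʷ k ++ w̃′)
      × (∀ b → IsPrefix (w̃′ ++ [ b ]) w̃ → b ≡ c)
  long-prefix-desubstitution {w̃ = w̃} {X} {c = c} {s′} k refl refl X-ends conj with φ-split-after-prefix X w̃ X-ends (sym X𝟎^qcG≡Φw̃)
    where
    G = s′ ++ 𝟎^ q ++ [ 𝟏 ]
    X𝟎^qcG≡Φw̃ : X ++ 𝟎^ q ++ c ∷ G ≡ Φ w̃
    X𝟎^qcG≡Φw̃ = ∷-injectiveʳ (++-cancelˡ (𝟎^ q) _ _ (trans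
      (solve 5 (λ O_q 𝟏 X c s′ → O_q ⊕ 𝟏 ⊕ X ⊕ O_q ⊕ c ⊕ s′ ⊕ O_q ⊕ 𝟏 ⊜ ((O_q ⊕ 𝟏 ⊕ X ⊕ O_q) ⊕ c ⊕ s′) ⊕ O_q ⊕ 𝟏)
        refl (𝟎^ q) [ 𝟏 ] X [ c ] s′) conj))
  ... | w̃′ , z , refl , Φw̃′≡X , Φz≡ = w̃′ , (z , z≢[] , refl) , v≡T , next-letter
    where
    open ≡-Reasoning
    w′ = 𝟎^ q ++ 𝟏 ∷ X ++ 𝟎^ q
    w = w′ ++ c ∷ s′
    z≢[] : z ≢ []
    z≢[] refl = []≢++∷ (𝟎^ q) Φz≡
    v≡T : w ^ʷ k ++ w′ ≡ T p q ((w̃′ ++ z) ^ʷ k ++ w̃′)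
    v≡T = begin
      w ^ʷ k ++ 𝟎^ q ++ 𝟏 ∷ X ++ 𝟎^ q
        ≡⟨ solve 4 (λ wᵏ O_q 𝟏 X → wᵏ ⊕ O_q ⊕ 𝟏 ⊕ X ⊕ O_q ⊜ (wᵏ ⊕ O_q ⊕ 𝟏) ⊕ X ⊕ O_q) refl (w ^ʷ k) (𝟎^ q) [ 𝟏 ] X ⟩
      (w ^ʷ k ++ 𝟎^ q ++ [ 𝟏 ]) ++ X ++ 𝟎^ q
        ≡⟨ cong₂ (λ u v → u ++ v ++ 𝟎^ q) (ConjugateImage-^ʷ w (w̃′ ++ z) conj k) (sym Φw̃′≡X) ⟩
      (𝟎^ q ++ 𝟏 ∷ Φ ((w̃′ ++ z) ^ʷ k)) ++ Φ w̃′ ++ 𝟎^ q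
        ≡⟨ solve 5 (λ O_q 𝟏 Φw̃ᵏ Φw̃′ O_q′ → (O_q ⊕ 𝟏 ⊕ Φw̃ᵏ) ⊕ Φw̃′ ⊕ O_q′ ⊜ O_q ⊕ 𝟏 ⊕ (Φw̃ᵏ ⊕ Φw̃′) ⊕ O_q′)
             refl (𝟎^ q) [ 𝟏 ] (Φ ((w̃′ ++ z) ^ʷ k)) (Φ w̃′) (𝟎^ q) ⟩
      𝟎^ q ++ 𝟏 ∷ (Φ ((w̃′ ++ z) ^ʷ k) ++ Φ w̃′) ++ 𝟎^ q
        ≡⟨ cong (λ u → 𝟎^ q ++ 𝟏 ∷ u ++ 𝟎^ q) (sym (φ-++ ((w̃′ ++ z) ^ʷ k) w̃′)) ⟩
      T p q ((w̃′ ++ z) ^ʷ k ++ w̃′) ∎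
    next-letter : ∀ b → IsPrefix (w̃′ ++ [ b ]) (w̃′ ++ z) → b ≡ c
    next-letter b (R , w̃≡) with ++-cancelˡ w̃′ z (b ∷ R) (trans w̃≡ (++-assoc w̃′ [ b ] R))
    ... | refl = letter-after-𝟎^q b c Φz≡

  InL-[framed]ᵏ𝟎^i-b⇒𝟏𝟎^[m+i]b : ∀ a K j mid m i b → L (a ∷ (framed j mid m ^ʷ suc K ++ 𝟎^ i) ++ [ b ]) →
    L (𝟏 ∷ 𝟎^ (m + i) ++ [ b ])
  InL-[framed]ᵏ𝟎^i-b⇒𝟏𝟎^[m+i]b a K j mid m i b = InL-suffix _ (a ∷ W ^ʷ K ++ 𝟎^ j ++ 𝟏 ∷ mid) (begin
      a ∷ (W ^ʷ suc K ++ 𝟎^ i) ++ [ b ]   ≡⟨ cong (λ u → a ∷ (u ++ 𝟎^ i) ++ [ b ]) (^ʷ-sucʳ W K) ⟩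
      a ∷ ((W ^ʷ K ++ W) ++ 𝟎^ i) ++ [ b ]
        ≡⟨ solve 8 (λ a Wᴷ O_j 𝟏 mid O_m O_i b → a ⊕ ((Wᴷ ⊕ (O_j ⊕ 𝟏 ⊕ mid ⊕ 𝟏 ⊕ O_m)) ⊕ O_i) ⊕ b
                                               ⊜ (a ⊕ Wᴷ ⊕ O_j ⊕ 𝟏 ⊕ mid) ⊕ 𝟏 ⊕ (O_m ⊕ O_i) ⊕ b)
             refl [ a ] (W ^ʷ K) (𝟎^ j) [ 𝟏 ] mid (𝟎^ m) (𝟎^ i) [ b ] ⟩
      (a ∷ W ^ʷ K ++ 𝟎^ j ++ 𝟏 ∷ mid) ++ 𝟏 ∷ (𝟎^ m ++ 𝟎^ i) ++ [ b ]
        ≡⟨ cong (λ u → (a ∷ W ^ʷ K ++ 𝟎^ j ++ 𝟏 ∷ mid) ++ 𝟏 ∷ u ++ [ b ]) (𝟎^-+ m i) ⟩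
      (a ∷ W ^ʷ K ++ 𝟎^ j ++ 𝟏 ∷ mid) ++ 𝟏 ∷ 𝟎^ (m + i) ++ [ b ] ∎)
    where
    open ≡-Reasoning
    W = framed j mid m

  -- For w′ = 0^i, the zero run closing v b contradicts the gaps of u_β, or v desubstitutes to a
  -- word excluded by 𝟎[y𝟏]ᵏy𝟎∉L or 𝟏[y𝟎]ᵏy𝟏∉L.
  short-prefix-impossible : ∀ {a m} (bd : Borders a m) mid y j i b → Φ y ≡ mid ++ [ 𝟏 ] → p ≤ 4 + j →
    (i < q × b ≡ 𝟏 ⊎ i ≡ q × b ≡ 𝟎) → ¬ L (a ∷ (framed q mid m ^ʷ (4 + j) ++ 𝟎^ i) ++ [ b ])
  short-prefix-impossible ends𝟏 mid y j i _ _ _ (inj₁ (i<q , refl)) h =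
    <⇒≱ i<q (InL-𝟏𝟎^s𝟏⇒q≤s i (InL-[framed]ᵏ𝟎^i-b⇒𝟏𝟎^[m+i]b 𝟎 (3 + j) q mid 0 i 𝟏 h))
  short-prefix-impossible ends𝟏 mid y j _ _ Φy≡ _ (inj₂ (refl , refl)) h =
    𝟎[y𝟏]ᵏy𝟎∉L y j (InL-desubstitute 𝟎 𝟎 _ (subst (λ u → L (𝟎 ∷ u ++ [ 𝟎 ])) v≡T h))
    where
    v≡T : framed q mid 0 ^ʷ (4 + j) ++ 𝟎^ q ≡ T p q ((y ++ [ 𝟏 ]) ^ʷ (3 + j) ++ y)
    v≡T = ConjugateImage-^ʷ-𝟎^q (framed q mid 0) y 𝟏 (ConjugateImage-framed ends𝟏 mid y Φy≡) (3 + j)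
  short-prefix-impossible (ends𝟎 m 1+m+q≡p) mid y j i _ Φy≡ p≤4+j (inj₁ (i<q , refl)) h =
    𝟏[y𝟎]ᵏy𝟏∉L y (1 + j) (φ-preimage-nonempty y Φy≡) p≤4+j p≤q+q
      (InL-desubstitute 𝟏 𝟏 _ (subst (λ u → L (𝟏 ∷ u ++ [ 𝟏 ])) v≡T h))
    where
    open ≡-Reasoning
    1+m+i≡q : suc m + i ≡ q
    1+m+i≡q = InL-𝟏𝟎^s𝟏⇒s<p⇒s≡q (suc m + i) (subst (suc m + i <_) 1+m+q≡p (+-monoʳ-< (suc m) i<q))
      (InL-[framed]ᵏ𝟎^i-b⇒𝟏𝟎^[m+i]b 𝟏 (3 + j) q mid (suc m) i 𝟏 h)
    W = framed q mid (suc m)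
    Y = (y ++ [ 𝟎 ]) ^ʷ (3 + j) ++ y
    p≤q+q : p ≤ q + q
    p≤q+q = subst (_≤ q + q) 1+m+q≡p (+-monoˡ-≤ q (subst (suc m ≤_) 1+m+i≡q (m≤m+n (suc m) i)))
    v≡T : W ^ʷ (4 + j) ++ 𝟎^ i ≡ T p q Y
    v≡T = ++-cancelʳ (𝟎^ suc m) _ _ (begin
      (W ^ʷ (4 + j) ++ 𝟎^ i) ++ 𝟎^ suc m   ≡⟨ ++-assoc (W ^ʷ (4 + j)) (𝟎^ i) (𝟎^ suc m) ⟩
      W ^ʷ (4 + j) ++ 𝟎^ i ++ 𝟎^ suc m     ≡⟨ cong (W ^ʷ (4 + j) ++_) (trans (𝟎^-+ i (suc m)) (cong 𝟎^_ (trans (+-comm i (suc m)) 1+m+i≡q))) ⟩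
      W ^ʷ (4 + j) ++ 𝟎^ q                ≡⟨ ConjugateImage-^ʷ-𝟎^q W y 𝟎 (ConjugateImage-framed (ends𝟎 m 1+m+q≡p) mid y Φy≡) (3 + j) ⟩
      𝟎^ q ++ 𝟏 ∷ Φ Y ++ 𝟎^ p              ≡⟨ cong (λ u → 𝟎^ q ++ 𝟏 ∷ Φ Y ++ u) (trans (cong 𝟎^_ (trans (sym 1+m+q≡p) (+-comm (suc m) q))) (sym (𝟎^-+ q (suc m)))) ⟩
      𝟎^ q ++ 𝟏 ∷ Φ Y ++ 𝟎^ q ++ 𝟎^ suc m
        ≡⟨ solve 4 (λ O_q 𝟏 ΦY O_m → O_q ⊕ 𝟏 ⊕ ΦY ⊕ O_q ⊕ O_m ⊜ (O_q ⊕ 𝟏 ⊕ ΦY ⊕ O_q) ⊕ O_m) refl (𝟎^ q) [ 𝟏 ] (Φ Y) (𝟎^ suc m) ⟩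
      T p q Y ++ 𝟎^ suc m                 ∎)
  short-prefix-impossible (ends𝟎 m 1+m+q≡p) mid y j _ _ _ _ (inj₂ (refl , refl)) h =
    𝟎^1+p∉L (subst (λ n → L (𝟎^ suc n)) 1+m+q≡p
      (InL-𝟏𝟎^s𝟎⇒𝟎^1+s∈L _ (InL-[framed]ᵏ𝟎^i-b⇒𝟏𝟎^[m+i]b 𝟏 (3 + j) q mid (suc m) q 𝟎 h)))

  framed-decomposition : ∀ w → 2 ≤ count𝟏 w → Σ[ j ∈ ℕ ] Σ[ mid ∈ Word ] Σ[ m ∈ ℕ ] w ≡ framed j mid m
  framed-decomposition w 2≤#𝟏 with count𝟏 w in count≡
  ... | suc zero with 2≤#𝟏
  ...   | s≤s ()
  framed-decomposition w 2≤#𝟏 | suc (suc _) with first𝟏 w count≡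
  ... | j , r , refl , count-r with last𝟏 r count-r
  ... | mid , m , refl = j , mid , m , refl

  record Desubstituted (w w′ : Word) (k : ℕ) (a b : Letter) : Set where
    field
      w̃ w̃′ : Word
      2≤|w̃| : 2 ≤ length w̃
      w̃′⊏w̃ : IsProperPrefix w̃′ w̃
      w≈w̃ : ConjugateImage w w̃
      v≡T : w ^ʷ k ++ w′ ≡ T p q (w̃ ^ʷ k ++ w̃′)
      w̃′b⋢w̃ : ¬ IsPrefix (w̃′ ++ [ b ]) w̃
      a⋣w̃ : ¬ IsSuffix [ a ] w̃

  desubstitute-framed : ∀ {a j₀ m} → j₀ ≡ q × Borders a m → ∀ mid → Σ[ y ∈ Word ] Φ y ≡ mid ++ [ 𝟏 ] →
    ∀ w′ c s′ j b → let w = framed j₀ mid m in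
    w ≡ w′ ++ c ∷ s′ → c ≢ b → L w → p ≤ 4 + j → L (a ∷ (w ^ʷ (4 + j) ++ w′) ++ [ b ]) →
    Desubstituted w w′ (4 + j) a b
  desubstitute-framed {m = m} (refl , bd) mid (y , Φy≡) w′ c s′ j b w≡w′cs′ c≢b w∈L p≤k avb∈L
    with prefix-of-𝟎^𝟏 q w′ c s′ (mid ++ 𝟏 ∷ 𝟎^ m) (sym w≡w′cs′)
  ... | inj₁ (i , refl , short) = ⊥-elim (short-prefix-impossible bd mid y j i b Φy≡ p≤k (next-letter short) avb∈L)
    where
    next-letter : ∀ {i} → i < q × c ≡ 𝟎 ⊎ i ≡ q × c ≡ 𝟏 → i < q × b ≡ 𝟏 ⊎ i ≡ q × b ≡ 𝟎
    next-letter (inj₁ (i<q , refl)) = inj₁ (i<q , 𝟎≢⇒≡𝟏 c≢b)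
    next-letter (inj₂ (i≡q , refl)) = inj₂ (i≡q , 𝟏≢⇒≡𝟎 c≢b)
  ... | inj₂ (w″ , refl) with split-trailing-𝟎s w″
  ... | X , r , refl , X-ends
    with long-prefix-desubstitution (4 + j) (trailing-𝟎s-of-prefix≡q (4 + j) w≡w′cs′ X-ends w∈L avb∈L c≢b)
           w≡w′cs′ X-ends (ConjugateImage-framed bd mid y Φy≡)
  ... | w̃′ , w̃′⊏w̃ , v≡T , next≡c = record
    { w̃ = y ++ [ lastLetter bd ] ; w̃′ = w̃′
    ; 2≤|w̃| = subst (2 ≤_) (sym (length-++ y)) (+-monoˡ-≤ 1 (φ-preimage-nonempty y Φy≡))
    ; w̃′⊏w̃ = w̃′⊏w̃ ; w≈w̃ = ConjugateImage-framed bd mid y Φy≡ ; v≡T = v≡T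
    ; w̃′b⋢w̃ = λ w̃′b⊑w̃ → c≢b (sym (next≡c b w̃′b⊑w̃)) ; a⋣w̃ = a⋣lastLetter bd y }

  desubstitute-decomposed : ∀ {w a} → Σ[ j₀ ∈ ℕ ] Σ[ mid ∈ Word ] Σ[ m ∈ ℕ ] w ≡ framed j₀ mid m →
    ∀ w′ c s′ j b → w ≡ w′ ++ c ∷ s′ → c ≢ b → L w → L (w ++ w) → L (a ∷ w) → ¬ IsSuffix [ a ] w →
    p ≤ 4 + j → L (a ∷ (w ^ʷ (4 + j) ++ w′) ++ [ b ]) → Desubstituted w w′ (4 + j) a b
  desubstitute-decomposed {a = a} (j₀ , mid , m , refl) w′ c s′ j b w≡w′cs′ c≢b w∈L ww∈L aw∈L a⋣w =
    desubstitute-framed (borders a j₀ mid m ww∈L aw∈L a⋣w) mid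
      (InL-𝟏M𝟏⇒image mid (InL-infix _ (𝟎^ j₀) (𝟎^ m) (cong (λ u → 𝟎^ j₀ ++ 𝟏 ∷ u) (sym (++-assoc mid [ 𝟏 ] (𝟎^ m)))) w∈L))
      w′ c s′ j b w≡w′cs′ c≢b w∈L

  desubstitute : ∀ w w′ k a b → L w → 2 ≤ count𝟏 w → IsProperPrefix w′ w → 4 ≤ k → p ≤ k →
    L (a ∷ (w ^ʷ k ++ w′) ++ [ b ]) → ¬ IsPrefix (w′ ++ [ b ]) w → ¬ IsSuffix [ a ] w →
    Desubstituted w w′ k a b
  desubstitute w w′ .(4 + j) a b w∈L 2≤#𝟏 ([] , []≢[] , _) (s≤s (s≤s (s≤s (s≤s {n = j} _)))) _ _ _ _ =
    ⊥-elim ([]≢[] refl)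
  desubstitute w w′ .(4 + j) a b w∈L 2≤#𝟏 (c ∷ s′ , _ , w≡w′cs′) (s≤s (s≤s (s≤s (s≤s {n = j} _)))) p≤k avb∈L w′b⋢w a⋣w =
    desubstitute-decomposed (framed-decomposition w 2≤#𝟏) w′ c s′ j b w≡w′cs′ c≢b w∈L ww∈L aw∈L a⋣w p≤k avb∈L
    where
    Wʲ = w ^ʷ j
    ww∈L : L (w ++ w)
    ww∈L = InL-infix _ [ a ] ((w ++ w ++ Wʲ) ++ w′ ++ [ b ])
      (solve 5 (λ a w Wʲ w′ b → a ⊕ ((w ⊕ w ⊕ w ⊕ w ⊕ Wʲ) ⊕ w′) ⊕ b ⊜ a ⊕ (w ⊕ w) ⊕ ((w ⊕ w ⊕ Wʲ) ⊕ w′ ⊕ b))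
        refl [ a ] w Wʲ w′ [ b ]) avb∈L
    aw∈L : L (a ∷ w)
    aw∈L = InL-prefix _ ((w ++ w ++ w ++ Wʲ) ++ w′ ++ [ b ])
      (solve 5 (λ a w Wʲ w′ b → a ⊕ ((w ⊕ w ⊕ w ⊕ w ⊕ Wʲ) ⊕ w′) ⊕ b ⊜ (a ⊕ w) ⊕ ((w ⊕ w ⊕ w ⊕ Wʲ) ⊕ w′ ⊕ b))
        refl [ a ] w Wʲ w′ [ b ]) avb∈L
    c≢b : c ≢ b
    c≢b refl = w′b⋢w (s′ , trans w≡w′cs′ (sym (++-assoc w′ [ c ] s′)))

mainTheorem4 : (p q : ℕ) → 1 ≤ q → q < p → 3 < p →
    (w w′ : Word) (k : ℕ) (a b : Letter) →
    InL p q w → 2 ≤ count𝟏 w → IsProperPrefix w′ w → p ≤ k →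
    InL p q (a ∷ ((w ^ʷ k) ++ w′) ++ (b ∷ [])) →
    ¬ IsPrefix (w′ ++ (b ∷ [])) w → ¬ IsSuffix (a ∷ []) w →
    Σ Word λ w̃ → Σ Word λ w̃′ →
      ((2 ≤ length w̃) × IsProperPrefix w̃′ w̃
        × (w ++ replicate q 𝟎 ++ (𝟏 ∷ []) ≡ replicate q 𝟎 ++ (𝟏 ∷ []) ++ φ p q w̃)
        × ((w ^ʷ k) ++ w′ ≡ T p q ((w̃ ^ʷ k) ++ w̃′)))
      × ((u u′ : Word) → 2 ≤ length u → IsProperPrefix u′ u
          → (w ++ replicate q 𝟎 ++ (𝟏 ∷ []) ≡ replicate q 𝟎 ++ (𝟏 ∷ []) ++ φ p q u)
          → ((w ^ʷ k) ++ w′ ≡ T p q ((u ^ʷ k) ++ u′))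
          → (u ≡ w̃) × (u′ ≡ w̃′))
      × InL p q (a ∷ ((w̃ ^ʷ k) ++ w̃′) ++ (b ∷ []))
      × ¬ IsPrefix (w̃′ ++ (b ∷ [])) w̃
      × ¬ IsSuffix (a ∷ []) w̃
mainTheorem4 p q 1≤q q<p 3<p w w′ k a b w∈L 2≤#𝟏 w′⊏w p≤k avb∈L w′b⋢w a⋣w =
  w̃ , w̃′ , (2≤|w̃| , w̃′⊏w̃ , w≈w̃ , v≡T) ,
  (λ u u′ _ _ w≈u v≡Tᵤ → desubstitution-unique {w} {w′} {k} w≈w̃ v≡T w≈u v≡Tᵤ) ,
  InL-desubstitute a b _ (subst (λ t → L (a ∷ t ++ [ b ])) v≡T avb∈L) ,
  w̃′b⋢w̃ , a⋣w̃
  where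
  open Desubstitution p q 1≤q q<p
  open Desubstituted (desubstitute w w′ k a b w∈L 2≤#𝟏 w′⊏w (≤-trans 3<p p≤k) p≤k avb∈L w′b⋢w a⋣w)
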